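{- Let $n = 2k - 1$ be an odd positive integer, let $G$ be the king graph on $A = [0;n-1]^2$, let $H$ be the grid graph on $[0;k-1]^2$, and let $P$ be a snake path in $G$ of the greatest possible length. Suppose that every even cell of $A$ is nice relative to $P$ and that $P$ visits no odd cells. Then there is a Hamiltonian path $\rho$ in $H$ such that $P = \psi(\rho)$.
   Context: King graph: distinct cells adjacent iff both coordinate differences have absolute value at most $1$; grid graph: adjacent iff Euclidean distance $1$. Snake path: path that is an induced subgraph; length = number of edges. A cell $(x,y)$ is even if $x,y$ are both even, odd if both are odd. An even cell $a$ of $A$ is nice relative to $P$ if either $P$ visits $a$, or $P$ does not visit $a$ but $P$ traverses exactly one edge of $G$ joining two of the cells of $a+\{(1,0),(0,1),(-1,0),(0,-1)\}$ (cells outside $A$ being ignored). For a path $\rho$ in $H$ and an interior vertex $b$ with $\rho$-neighbours $u,v$, $\rho$ makes a turn at $b$ if $u-b\ne -(v-b)$. $\varphi(\rho)$ is the path in $G$ obtained by replacing each edge $a'a''$ of $\rho$ by $2a'$---$(a'+a'')$---$2a''$; $\psi(\rho)$ is obtained from $\varphi(\rho)$ by replacing, for each vertex $b$ where $\rho$ turns with $\rho$-neighbours $a',a''$, the subpath $(a'+b)$---$2b$---$(b+a'')$ by the single edge $(a'+b)$---$(b+a'')$. -}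

module Defs where

open import Data.Nat using (ℕ; zero; suc; _+_; _*_; _∸_; _≤_; _<_; ∣_-_∣; _≡ᵇ_)
open import Data.Nat.Divisibility using (_∣_)
open import Data.Nat.Properties using (_≟_; _<?_)
open import Data.Bool using (Bool; true; false; if_then_else_; _∧_; not)
open import Data.Product using (_×_; _,_; proj₁; proj₂)
open import Data.List using (List; []; _∷_; length; filter; _++_)
open import Data.List.Relation.Unary.All using (All)
open import Data.List.Relation.Unary.Linked using (Linked)
open import Data.List.Relation.Unary.Unique.Propositional using (Unique)
open import Data.List.Membership.Propositional using (_∈_)
open import Data.Unit using (⊤)
open import Data.Sum using (_⊎_)
open import Relation.Nullary using (¬_)
open import Relation.Nullary.Decidable using (_×-dec_)
open import Relation.Unary using (Decidable)
open import Relation.Binary.PropositionalEquality using (_≡_; _≢_)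

-- Cells of ℤ² restricted to nonnegative coordinates (all sets here lie in ℕ²).
Cell : Set
Cell = ℕ × ℕ

InSquare : ℕ → Cell → Set
InSquare m (x , y) = x < m × y < m

KingAdj : Cell → Cell → Set
KingAdj (x , y) (x' , y') = (x , y) ≢ (x' , y') × ∣ x - x' ∣ ≤ 1 × ∣ y - y' ∣ ≤ 1

GridAdj : Cell → Cell → Set
GridAdj (x , y) (x' , y') = ∣ x - x' ∣ + ∣ y - y' ∣ ≡ 1

FarNonAdj : (Cell → Cell → Set) → List Cell → Set
FarNonAdj Adj [] = ⊤
FarNonAdj Adj (u ∷ []) = ⊤
FarNonAdj Adj (u ∷ v ∷ ws) = All (λ w → ¬ Adj u w) ws × FarNonAdj Adj (v ∷ ws)

IsPath : (Cell → Set) → (Cell → Cell → Set) → List Cell → Set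
IsPath V Adj p = p ≢ [] × All V p × Unique p × Linked Adj p

IsSnake : (Cell → Set) → (Cell → Cell → Set) → List Cell → Set
IsSnake V Adj p = IsPath V Adj p × FarNonAdj Adj p

pathLength : List Cell → ℕ
pathLength p = length p ∸ 1

IsHamiltonian : (Cell → Set) → (Cell → Cell → Set) → List Cell → Set
IsHamiltonian V Adj p = IsPath V Adj p × (∀ c → V c → c ∈ p)

EvenCell : Cell → Set
EvenCell (x , y) = 2 ∣ x × 2 ∣ y

OddCell : Cell → Set
OddCell (x , y) = ¬ (2 ∣ x) × ¬ (2 ∣ y)

edges : List Cell → List (Cell × Cell)
edges [] = []
edges (u ∷ []) = []
edges (u ∷ v ∷ ws) = (u , v) ∷ edges (v ∷ ws)

InCross : ℕ → Cell → Cell → Set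
InCross n a c = GridAdj a c × InSquare n c

inCross? : (n : ℕ) (a : Cell) → Decidable (InCross n a)
inCross? n (x , y) (x' , y') =
  ((∣ x - x' ∣ + ∣ y - y' ∣) ≟ 1) ×-dec ((x' <? n) ×-dec (y' <? n))

crossEdgeCount : ℕ → Cell → List Cell → ℕ
crossEdgeCount n a P =
  length (filter (λ e → inCross? n a (proj₁ e) ×-dec inCross? n a (proj₂ e)) (edges P))

Nice : ℕ → List Cell → Cell → Set
Nice n P a = a ∈ P ⊎ (¬ (a ∈ P) × crossEdgeCount n a P ≡ 1)

dbl : Cell → Cell
dbl (x , y) = (2 * x , 2 * y)

addC : Cell → Cell → Cell
addC (x , y) (x' , y') = (x + x' , y + y')

-- ρ makes a turn at b (neighbours u, v): u - b ≠ -(v - b), i.e. u + v ≠ 2b.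
turns : Cell → Cell → Cell → Bool
turns (ux , uy) (bx , by) (vx , vy) =
  not (((ux + vx) ≡ᵇ (2 * bx)) ∧ ((uy + vy) ≡ᵇ (2 * by)))

-- φ(ρ): each edge a'a'' replaced by 2a' — (a'+a'') — 2a''.
φ-tail : Cell → List Cell → List Cell
φ-tail prev [] = []
φ-tail prev (b ∷ rest) = addC prev b ∷ dbl b ∷ φ-tail b rest

φ : List Cell → List Cell
φ [] = []
φ (a ∷ rest) = dbl a ∷ φ-tail a rest

-- ψ(ρ): as φ(ρ), but at each interior vertex b where ρ turns, the subpath
-- (a'+b) — 2b — (b+a'') is shortcut to (a'+b) — (b+a''), i.e. 2b is dropped.
ψ-tail : Cell → List Cell → List Cell
ψ-tail prev [] = []
ψ-tail prev (b ∷ []) = addC prev b ∷ dbl b ∷ []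
ψ-tail prev (b ∷ c ∷ rest) =
  addC prev b ∷ ((if turns prev b c then [] else (dbl b ∷ [])) ++ ψ-tail b (c ∷ rest))

ψ : List Cell → List Cell
ψ [] = []
ψ (a ∷ rest) = dbl a ∷ ψ-tail a rest

{-# OPTIONS --safe #-}
module Submission where

-- Since P avoids odd cells, each of its cells is a double 2v or the midpoint r + c of a grid edge
-- r─c. Call the star of v the cell 2v together with its four grid neighbours; adjacent cells of
-- P lie in a common star. A midpoint cannot be an end of P, since niceness of 2r and 2c would give
-- it neighbours in both stars, which share only the midpoint. So P starts at some 2v, and after
-- each midpoint r + c comes either 2c (followed by the midpoint of a straight continuation c─d, or
-- by nothing) or the midpoint of an edge c─d turning at c: every other continuation puts three
-- consecutive cells of P in one star, or breaks inducedness, against niceness. Reading off the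
-- vertices gives ρ with P = ψ ρ. P never re-enters the star of a vertex it has passed, so ρ has no
-- repetitions, and niceness of 2c puts a cell of P in the star of c, so ρ visits every c.

open import Defs
open import Data.Nat using (ℕ; zero; suc; _+_; _*_; _∸_; _≤_; _<_; s≤s; z≤n; ∣_-_∣; _≡ᵇ_)
open import Data.Nat.Properties
  using ( suc-injective; +-suc; +-comm; +-identityʳ; +-cancelˡ-≡; +-cancelʳ-≡; *-suc; *-comm
        ; *-cancelˡ-≡; *-cancelˡ-<; even≢odd; ≡ᵇ⇒≡; ≡⇒≡ᵇ; ∣m-n∣≡0⇒m≡n; ∣n-n∣≡0; ∣-∣-comm
        ; n≤1+n; ≤-refl; ≤-trans
        ; +-monoʳ-≤; *-monoʳ-≤; module ≤-Reasoning)
open import Data.Nat.Divisibility using (_∣_; divides)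
open import Data.Product using (Σ; ∃-syntax; _×_; _,_; proj₁; proj₂)
open import Data.Sum using (_⊎_; inj₁; inj₂; swap)
open import Data.Empty using (⊥; ⊥-elim)
open import Relation.Nullary using (¬_; contradiction; yes; no)
open import Function using (_∘_)
open import Data.Bool using (true; false; T; if_then_else_)
open import Data.Unit using (tt)
open import Data.List using (List; []; _∷_; _++_; _∷ʳ_; length; filter)
open import Data.List.Properties using (++-assoc; filter-accept; ∷ʳ-injectiveʳ)
open import Data.List.Membership.Propositional using (_∈_; _∉_)
open import Data.List.Membership.Propositional.Properties using (∈-++⁺ʳ; ∈-++⁻; ∈-filter⁻)
open import Data.List.Relation.Unary.Any using (here; there)
open import Data.List.Relation.Unary.All as All using (All; []; _∷_)
open import Data.List.Relation.Unary.AllPairs using ([]; _∷_)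
open import Data.List.Relation.Unary.Linked as Linked using (Linked; []; [-]; _∷_)
open import Data.List.Relation.Unary.Unique.Propositional using (Unique)
import Data.List.Relation.Unary.Unique.Propositional.Properties as Unique
open import Relation.Unary using (Decidable)
open import Relation.Nullary.Decidable using (_×-dec_)
open import Relation.Binary.PropositionalEquality
  using (_≡_; _≢_; refl; sym; trans; cong; cong₂; subst; subst₂)

data Step : ℕ → ℕ → Set where
  up   : ∀ {x} → Step x (suc x)
  down : ∀ {x} → Step (suc x) x

data Near (x y : ℕ) : Set where
  same  : x ≡ y → Near x y
  above : y ≡ suc x → Near x y
  below : x ≡ suc y → Near x y

n+n≡2*n : ∀ x → x + x ≡ 2 * x
n+n≡2*n x = cong (x +_) (sym (+-identityʳ x))

step-sym : ∀ {x y} → Step x y → Step y x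
step-sym up   = down
step-sym down = up

step≢ : ∀ {x y} → Step x y → x ≢ y
step≢ up   ()
step≢ down ()

near-sym : ∀ {x y} → Near x y → Near y x
near-sym (same e)  = same (sym e)
near-sym (above e) = below e
near-sym (below e) = above e

step⇒near : ∀ {x y} → Step x y → Near x y
step⇒near up   = above refl
step⇒near down = below refl

∣-∣≡1⇒step : ∀ x y → ∣ x - y ∣ ≡ 1 → Step x y
∣-∣≡1⇒step zero    (suc zero) _ = up
∣-∣≡1⇒step (suc zero) zero    _ = down
∣-∣≡1⇒step (suc x) (suc y) e with ∣-∣≡1⇒step x y e
... | up   = up
... | down = down

step⇒∣-∣≡1 : ∀ {x y} → Step x y → ∣ x - y ∣ ≡ 1
step⇒∣-∣≡1 (up {x}) = ∣n-1+n∣ x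
  where
  ∣n-1+n∣ : ∀ n → ∣ n - suc n ∣ ≡ 1
  ∣n-1+n∣ zero    = refl
  ∣n-1+n∣ (suc n) = ∣n-1+n∣ n
step⇒∣-∣≡1 (down {x}) = trans (∣-∣-comm (suc x) x) (step⇒∣-∣≡1 (up {x}))

∣-∣≤1⇒near : ∀ x y → ∣ x - y ∣ ≤ 1 → Near x y
∣-∣≤1⇒near zero       zero       _ = same refl
∣-∣≤1⇒near zero       (suc zero) _ = above refl
∣-∣≤1⇒near (suc zero) zero       _ = below refl
∣-∣≤1⇒near (suc x)    (suc y)    h with ∣-∣≤1⇒near x y h
... | same e  = same (cong suc e)
... | above e = above (cong suc e)
... | below e = below (cong suc e)
∣-∣≤1⇒near zero          (suc (suc y)) (s≤s ())
∣-∣≤1⇒near (suc (suc x)) zero          (s≤s ())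

near⇒∣-∣≤1 : ∀ {x y} → Near x y → ∣ x - y ∣ ≤ 1
near⇒∣-∣≤1 {x} (same refl)  = subst (_≤ 1) (sym (∣n-n∣≡0 x)) z≤n
near⇒∣-∣≤1 {x} (above refl) = subst (_≤ 1) (sym (step⇒∣-∣≡1 (up {x}))) ≤-refl
near⇒∣-∣≤1 {y = y} (below refl) = subst (_≤ 1) (sym (step⇒∣-∣≡1 (down {y}))) ≤-refl

step-sum-odd : ∀ {x y} → Step x y → ∃[ m ] x + y ≡ suc (2 * m)
step-sum-odd (up {x})   = x , trans (+-suc x x) (cong suc (n+n≡2*n x))
step-sum-odd (down {x}) = x , cong suc (n+n≡2*n x)

near-doubles : ∀ v w → Near (2 * v) (2 * w) → v ≡ w
near-doubles v w (same e)  = *-cancelˡ-≡ v w 2 e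
near-doubles v w (above e) = ⊥-elim (even≢odd w v e)
near-doubles v w (below e) = ⊥-elim (even≢odd v w e)

near-double-odd : ∀ {v m} → Near (2 * v) (suc (2 * m)) → v ≡ m ⊎ v ≡ suc m
near-double-odd {v} {m} (same e)  = ⊥-elim (even≢odd v m e)
near-double-odd {v} {m} (above e) = inj₁ (*-cancelˡ-≡ v m 2 (sym (suc-injective e)))
near-double-odd {v} {m} (below e) = inj₂ (*-cancelˡ-≡ v (suc m) 2 (trans e (sym (*-suc 2 m))))

near-odds : ∀ {m n} → Near (suc (2 * m)) (suc (2 * n)) → m ≡ n
near-odds {m} {n} (same e)  = *-cancelˡ-≡ m n 2 (suc-injective e)
near-odds {m} {n} (above e) = ⊥-elim (even≢odd n m (suc-injective e))
near-odds {m} {n} (below e) = ⊥-elim (even≢odd m n (suc-injective e))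

double≢step-sum : ∀ v {x y} → Step x y → 2 * v ≢ x + y
double≢step-sum v s e with step-sum-odd s
... | m , e' = even≢odd v m (trans e e')

near-double-step : ∀ v {x y} → Step x y → Near (2 * v) (x + y) → v ≡ x ⊎ v ≡ y
near-double-step v (up {x})   n = near-double-odd (subst (Near _) (proj₂ (step-sum-odd (up {x}))) n)
near-double-step v (down {x}) n = swap (near-double-odd (subst (Near _) (proj₂ (step-sum-odd (down {x}))) n))

near-steps : ∀ {x y u w} → Step x y → Step u w → Near (x + y) (u + w) → x + y ≡ u + w
near-steps s t n with step-sum-odd s | step-sum-odd t
... | m , e | m' , e' with near-odds {m} {m'} (subst₂ Near e e' n)
... | refl = trans e (sym e')

near-pred : ∀ {x y} → Near (suc x) (suc y) → Near x y
near-pred (same e)  = same (suc-injective e)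
near-pred (above e) = above (suc-injective e)
near-pred (below e) = below (suc-injective e)

near-+ˡ : ∀ r {x y} → Near x y → Near (r + x) (r + y)
near-+ˡ r         (same refl)  = same refl
near-+ˡ r {x}     (above refl) = above (+-suc r x)
near-+ˡ r {y = y} (below refl) = below (+-suc r y)

near-cancelˡ : ∀ r {x y} → Near (r + x) (r + y) → Near x y
near-cancelˡ zero    n = n
near-cancelˡ (suc r) n = near-cancelˡ r (near-pred n)

¬near-2+ : ∀ x → ¬ Near (suc (suc x)) x
¬near-2+ zero    (same ())
¬near-2+ zero    (above ())
¬near-2+ zero    (below ())
¬near-2+ (suc x) n = ¬near-2+ x (near-pred n)

step-pair : ∀ {x a b} → Step x a → Step x b → a ≡ b ⊎ (a + b ≡ 2 * x × ¬ Near (x + a) (x + b))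
step-pair up up = inj₁ refl
step-pair down down = inj₁ refl
step-pair (up {suc b}) (down {b}) =
  inj₂ (trans (cong (suc ∘ suc) (n+n≡2*n b)) (sym (*-suc 2 b)) , ¬near-2+ b ∘ near-cancelˡ (suc b))
step-pair (down {a}) (up {suc a}) =
  inj₂ ( trans (trans (+-suc a (suc a)) (cong suc (+-suc a a)))
               (trans (cong (suc ∘ suc) (n+n≡2*n a)) (sym (*-suc 2 a)))
       , ¬near-2+ a ∘ near-sym ∘ near-cancelˡ (suc a))

near≤1+ : ∀ {x y} → Near x y → x ≤ suc y
near≤1+ {x} (same refl)  = n≤1+n x
near≤1+ {x} (above refl) = ≤-trans (n≤1+n x) (n≤1+n (suc x))
near≤1+     (below refl) = ≤-refl

half-bound : ∀ k {x s} → 2 * x ≤ suc s → s < 2 * k ∸ 1 → x < k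
half-bound (suc k) {x} {s} 2x≤1+s s<2k-1 = *-cancelˡ-< 2 x (suc k) (begin-strict
    2 * x         ≤⟨ 2x≤1+s ⟩
    suc s         <⟨ s≤s (subst (s <_) (cong (_∸ 1) (*-suc 2 k)) s<2k-1) ⟩
    2 + 2 * k     ≡⟨ *-suc 2 k ⟨
    2 * suc k     ∎)
  where open ≤-Reasoning

double-bound : ∀ k {x} → x < k → 2 * x < 2 * k ∸ 1
double-bound (suc k) {x} (s≤s x≤k) =
  subst (2 * x <_) (cong (_∸ 1) (sym (*-suc 2 k))) (s≤s (*-monoʳ-≤ 2 x≤k))

parity : ∀ n → (∃[ a ] n ≡ 2 * a) ⊎ (∃[ a ] n ≡ suc (2 * a))
parity zero = inj₁ (0 , refl)
parity (suc n) with parity n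
... | inj₁ (a , refl) = inj₂ (a , refl)
... | inj₂ (a , refl) = inj₁ (suc a , sym (*-suc 2 a))

step-double : ∀ {x y} → Step x y → Step (2 * x) (x + y)
step-double (up {x})   = subst (Step (2 * x)) (sym (proj₂ (step-sum-odd (up {x})))) up
step-double (down {x}) = subst₂ Step (sym (*-suc 2 x)) (sym (proj₂ (step-sum-odd (down {x})))) down

double-step⁻ : ∀ e {t z} → t ≡ 2 * e → Step t z → ∃[ a ] Step e a × z ≡ e + a
double-step⁻ e       eq up       = suc e , up , trans (cong suc eq) (sym (proj₂ (step-sum-odd (up {e}))))
double-step⁻ (suc a) eq (down {z}) =
  a , down , trans (suc-injective (trans eq (*-suc 2 a))) (cong suc (sym (n+n≡2*n a)))

¬2∣odd : ∀ a → ¬ (2 ∣ suc (2 * a))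
¬2∣odd a (divides q e) = even≢odd q a (sym (trans e (*-comm q 2)))

data Grid : Cell → Cell → Set where
  horizontal : ∀ {x x' y} → Step x x' → Grid (x , y) (x' , y)
  vertical   : ∀ {x y y'} → Step y y' → Grid (x , y) (x , y')

record King (u v : Cell) : Set where
  constructor king
  field
    distinct : u ≢ v
    near₁    : Near (proj₁ u) (proj₁ v)
    near₂    : Near (proj₂ u) (proj₂ v)
open King

GridAdj⇒Grid : ∀ u v → GridAdj u v → Grid u v
GridAdj⇒Grid (x , y) (x' , y') h with ∣ x - x' ∣ in ex | ∣ y - y' ∣ in ey | h
... | zero     | suc zero | _ with refl ← ∣m-n∣≡0⇒m≡n {x} {x'} ex = vertical (∣-∣≡1⇒step y y' ey)
... | suc zero | zero     | _ with refl ← ∣m-n∣≡0⇒m≡n {y} {y'} ey = horizontal (∣-∣≡1⇒step x x' ex)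

Grid⇒GridAdj : ∀ {u v} → Grid u v → GridAdj u v
Grid⇒GridAdj (horizontal {y = y} s) = cong₂ _+_ (step⇒∣-∣≡1 s) (∣n-n∣≡0 y)
Grid⇒GridAdj (vertical {x} s)       = cong₂ _+_ (∣n-n∣≡0 x) (step⇒∣-∣≡1 s)

KingAdj⇒King : ∀ u v → KingAdj u v → King u v
KingAdj⇒King (x , y) (x' , y') (ne , n₁ , n₂) = king ne (∣-∣≤1⇒near x x' n₁) (∣-∣≤1⇒near y y' n₂)

King⇒KingAdj : ∀ {u v} → King u v → KingAdj u v
King⇒KingAdj (king ne n₁ n₂) = ne , near⇒∣-∣≤1 n₁ , near⇒∣-∣≤1 n₂

grid-sym : ∀ {u v} → Grid u v → Grid v u
grid-sym (horizontal s) = horizontal (step-sym s)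
grid-sym (vertical s)   = vertical (step-sym s)

grid-irrefl : ∀ {u} → ¬ Grid u u
grid-irrefl (horizontal s) = step≢ s refl
grid-irrefl (vertical s)   = step≢ s refl

king-sym : ∀ {u v} → King u v → King v u
king-sym k = king (distinct k ∘ sym) (near-sym (near₁ k)) (near-sym (near₂ k))

king-irrefl : ∀ {u} → ¬ King u u
king-irrefl k = distinct k refl

grid⇒king : ∀ {u v} → Grid u v → King u v
grid⇒king (horizontal s) = king (step≢ s ∘ cong proj₁) (step⇒near s) (same refl)
grid⇒king (vertical s)   = king (step≢ s ∘ cong proj₂) (same refl) (step⇒near s)

addC-comm : ∀ a b → addC a b ≡ addC b a
addC-comm (a₁ , a₂) (b₁ , b₂) = cong₂ _,_ (+-comm a₁ b₁) (+-comm a₂ b₂)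

king-addC-comm : ∀ r c {x} → King (addC c r) x → King (addC r c) x
king-addC-comm r c {x} = subst (λ t → King t x) (addC-comm c r)

addC-cancelʳ : ∀ {a b c} → addC a c ≡ addC b c → a ≡ b
addC-cancelʳ {a₁ , a₂} {b₁ , b₂} {c₁ , c₂} e =
  cong₂ _,_ (+-cancelʳ-≡ c₁ a₁ b₁ (cong proj₁ e)) (+-cancelʳ-≡ c₂ a₂ b₂ (cong proj₂ e))

dbl-injective : ∀ {v w} → dbl v ≡ dbl w → v ≡ w
dbl-injective {v₁ , v₂} {w₁ , w₂} e =
  cong₂ _,_ (*-cancelˡ-≡ v₁ w₁ 2 (cong proj₁ e)) (*-cancelˡ-≡ v₂ w₂ 2 (cong proj₂ e))

dbl≢mid : ∀ {v r c} → Grid r c → dbl v ≢ addC r c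
dbl≢mid {v₁ , _} (horizontal s) = double≢step-sum v₁ s ∘ cong proj₁
dbl≢mid {_ , v₂} (vertical s)   = double≢step-sum v₂ s ∘ cong proj₂

¬king-dbl-dbl : ∀ {v w} → ¬ King (dbl v) (dbl w)
¬king-dbl-dbl {v₁ , v₂} {w₁ , w₂} k =
  distinct k (cong dbl (cong₂ _,_ (near-doubles v₁ w₁ (near₁ k)) (near-doubles v₂ w₂ (near₂ k))))

near-double-self : ∀ v y → Near (2 * v) (y + y) → v ≡ y
near-double-self v y n = near-doubles v y (subst (Near _) (n+n≡2*n y) n)

king-dbl-mid : ∀ {v r c} → Grid r c → King (dbl v) (addC r c) → v ≡ r ⊎ v ≡ c
king-dbl-mid {v₁ , v₂} (horizontal {y = y} s) k
  with near-double-step v₁ s (near₁ k) | near-double-self v₂ y (near₂ k)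
... | inj₁ refl | refl = inj₁ refl
... | inj₂ refl | refl = inj₂ refl
king-dbl-mid {v₁ , v₂} (vertical {x} s) k
  with near-double-self v₁ x (near₁ k) | near-double-step v₂ s (near₂ k)
... | refl | inj₁ refl = inj₁ refl
... | refl | inj₂ refl = inj₂ refl

near-selves : ∀ y w → Near (y + y) (w + w) → y ≡ w
near-selves y w n = near-doubles y w (subst₂ Near (n+n≡2*n y) (n+n≡2*n w) n)

near-self-step : ∀ v {x y} → Step x y → Near (v + v) (x + y) → v ≡ x ⊎ v ≡ y
near-self-step v {x} {y} s n = near-double-step v s (subst (λ z → Near z (x + y)) (n+n≡2*n v) n)

king-mid-mid : ∀ {r c p q} → Grid r c → Grid p q → King (addC r c) (addC p q) →
               ∃[ v ] (v ≡ r ⊎ v ≡ c) × (v ≡ p ⊎ v ≡ q)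
king-mid-mid (horizontal {y = y} s) (horizontal {y = w} t) k =
  ⊥-elim (distinct k (cong₂ _,_ (near-steps s t (near₁ k))
                                 (cong (λ z → z + z) (near-selves y w (near₂ k)))))
king-mid-mid (vertical {x} s) (vertical {u} t) k =
  ⊥-elim (distinct k (cong₂ _,_ (cong (λ z → z + z) (near-selves x u (near₁ k)))
                                 (near-steps s t (near₂ k))))
king-mid-mid (horizontal {y = y} s) (vertical {u} t) k =
  (u , y) , Data.Sum.map (cong (_, y)) (cong (_, y)) (near-self-step u s (near-sym (near₁ k)))
          , Data.Sum.map (cong (u ,_)) (cong (u ,_)) (near-self-step y t (near₂ k))
king-mid-mid (vertical {x} s) (horizontal {y = w} t) k =
  (x , w) , Data.Sum.map (cong (x ,_)) (cong (x ,_)) (near-self-step w s (near-sym (near₂ k)))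
          , Data.Sum.map (cong (_, w)) (cong (_, w)) (near-self-step x t (near₁ k))

grid-dbl-mid : ∀ {e a} → Grid e a → Grid (dbl e) (addC e a)
grid-dbl-mid (horizontal {x} {x'} {y} s) =
  subst (λ t → Grid (dbl (x , y)) (x + x' , t)) (sym (n+n≡2*n y)) (horizontal (step-double s))
grid-dbl-mid (vertical {x} {y} {y'} s) =
  subst (λ t → Grid (dbl (x , y)) (t , y + y')) (sym (n+n≡2*n x)) (vertical (step-double s))

grid-dbl⁻ : ∀ {e z} → Grid (dbl e) z → ∃[ a ] Grid e a × z ≡ addC e a
grid-dbl⁻ {e₁ , e₂} (horizontal s) with double-step⁻ e₁ refl s
... | a , t , refl = (a , e₂) , horizontal t , cong₂ _,_ refl (sym (n+n≡2*n e₂))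
grid-dbl⁻ {e₁ , e₂} (vertical s) with double-step⁻ e₂ refl s
... | a , t , refl = (e₁ , a) , vertical t , cong₂ _,_ (sym (n+n≡2*n e₁)) refl

dbl-even : ∀ v → EvenCell (dbl v)
dbl-even (v₁ , v₂) = divides v₁ (*-comm 2 v₁) , divides v₂ (*-comm 2 v₂)

classify : ∀ z → ¬ OddCell z → (∃[ v ] z ≡ dbl v) ⊎ (∃[ r ] ∃[ c ] Grid r c × z ≡ addC r c)
classify (x , y) ¬odd with parity x | parity y
... | inj₁ (a , refl) | inj₁ (b , refl) = inj₁ ((a , b) , refl)
... | inj₁ (a , refl) | inj₂ (b , refl) =
  inj₂ ( (a , b) , (a , suc b) , vertical up
       , cong₂ _,_ (sym (n+n≡2*n a)) (sym (proj₂ (step-sum-odd (up {b})))))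
... | inj₂ (a , refl) | inj₁ (b , refl) =
  inj₂ ( (a , b) , (suc a , b) , horizontal up
       , cong₂ _,_ (sym (proj₂ (step-sum-odd (up {a})))) (sym (n+n≡2*n b)))
... | inj₂ (a , refl) | inj₂ (b , refl) = ⊥-elim (¬odd (¬2∣odd a , ¬2∣odd b))

InStar : Cell → Cell → Set
InStar e z = z ≡ dbl e ⊎ Grid (dbl e) z

mid-in-star : ∀ {e a} → Grid e a → InStar e (addC e a)
mid-in-star g = inj₂ (grid-dbl-mid g)

king-centre : ∀ {e z} → ¬ OddCell z → King (dbl e) z → Grid (dbl e) z
king-centre {e} {z} ¬odd k with classify z ¬odd
... | inj₁ (v , refl) = ⊥-elim (¬king-dbl-dbl {e} {v} k)
... | inj₂ (p , q , g , refl) with king-dbl-mid {e} g k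
...   | inj₁ refl = grid-dbl-mid g
...   | inj₂ refl = subst (Grid (dbl e)) (addC-comm e p) (grid-dbl-mid (grid-sym g))

king-mid : ∀ {r c z} → Grid r c → ¬ OddCell z → King (addC r c) z → InStar r z ⊎ InStar c z
king-mid {z = z} g ¬odd k with classify z ¬odd
... | inj₁ (v , refl) with king-dbl-mid {v} g (king-sym k)
...   | inj₁ refl = inj₁ (inj₁ refl)
...   | inj₂ refl = inj₂ (inj₁ refl)
king-mid {z = z} g ¬odd k | inj₂ (p , q , h , refl) with king-mid-mid g h k
... | v , vrc , inj₁ refl = Data.Sum.map (λ { refl → mid-in-star h }) (λ { refl → mid-in-star h }) vrc
... | v , vrc , inj₂ refl = Data.Sum.map (λ { refl → star-flip }) (λ { refl → star-flip }) vrc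
  where star-flip = subst (InStar v) (addC-comm v p) (mid-in-star (grid-sym h))

star-dbl : ∀ {c x} → InStar c (dbl x) → c ≡ x
star-dbl (inj₁ e) = sym (dbl-injective e)
star-dbl {c} {x} (inj₂ g) = ⊥-elim (¬king-dbl-dbl {c} {x} (grid⇒king g))

star-mid : ∀ {c x y} → Grid x y → InStar c (addC x y) → c ≡ x ⊎ c ≡ y
star-mid {c} g (inj₁ e) = ⊥-elim (dbl≢mid {c} g (sym e))
star-mid {c} g (inj₂ h) = king-dbl-mid {c} g (grid⇒king h)

star-meet : ∀ {r c z} → Grid r c → InStar r z → InStar c z → z ≡ addC r c
star-meet {r} {c} g (inj₁ refl) sc = ⊥-elim (grid-irrefl (subst (Grid r) (star-dbl {c} {r} sc) g))
star-meet {r} {c} g (inj₂ h) sc with grid-dbl⁻ {r} h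
... | a , ga , refl with star-mid {c} ga sc
...   | inj₁ refl = ⊥-elim (grid-irrefl g)
...   | inj₂ refl = refl

Straight : Cell → Cell → Cell → Set
Straight a e b = addC a b ≡ dbl e

straight-sym : ∀ {a e b} → Straight a e b → Straight b e a
straight-sym {a} {e} {b} st = trans (addC-comm b a) st

arms-trichotomy : ∀ {e a b} → Grid e a → Grid e b →
                  a ≡ b
                ⊎ (Straight a e b × ¬ King (addC e a) (addC e b))
                ⊎ (¬ Straight a e b × King (addC e a) (addC e b))
arms-trichotomy (horizontal {y = y} s) (horizontal t) with step-pair s t
... | inj₁ refl          = inj₁ refl
... | inj₂ (sum , apart) = inj₂ (inj₁ (cong₂ _,_ sum (n+n≡2*n y) , apart ∘ near₁))
arms-trichotomy (vertical {x} s) (vertical t) with step-pair s t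
... | inj₁ refl          = inj₁ refl
... | inj₂ (sum , apart) = inj₂ (inj₁ (cong₂ _,_ (n+n≡2*n x) sum , apart ∘ near₂))
arms-trichotomy (horizontal {x} {ax} {y} s) (vertical t) =
  inj₂ (inj₂ ( (λ st → step≢ s (sym (+-cancelʳ-≡ x ax x (trans (cong proj₁ st) (sym (n+n≡2*n x))))))
             , king (λ e → step≢ s (sym (+-cancelˡ-≡ x ax x (cong proj₁ e))))
                    (near-+ˡ x (near-sym (step⇒near s))) (near-+ˡ y (step⇒near t))))
arms-trichotomy (vertical {x} {y} {ay} s) (horizontal t) =
  inj₂ (inj₂ ( (λ st → step≢ s (sym (+-cancelʳ-≡ y ay y (trans (cong proj₂ st) (sym (n+n≡2*n y))))))
             , king (λ e → step≢ s (sym (+-cancelˡ-≡ y ay y (cong proj₂ e))))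
                    (near-+ˡ x (step⇒near t)) (near-+ˡ y (near-sym (step⇒near s)))))

king-arms : ∀ {e a b} → Grid e a → Grid e b → a ≢ b → ¬ Straight a e b → King (addC e a) (addC e b)
king-arms ga gb a≢b bent with arms-trichotomy ga gb
... | inj₁ a≡b              = ⊥-elim (a≢b a≡b)
... | inj₂ (inj₁ (st , _))  = ⊥-elim (bent st)
... | inj₂ (inj₂ (_ , k))   = k

-- The third arm is opposite to at most one of the other two.
third-arm : ∀ {e a b c} → Grid e a → Grid e b → Grid e c → King (addC e a) (addC e b) →
            c ≡ a ⊎ c ≡ b ⊎ King (addC e a) (addC e c) ⊎ King (addC e b) (addC e c)
third-arm {e} {a} {b} {c} ga gb gc k with arms-trichotomy ga gc
... | inj₁ refl             = inj₁ refl
... | inj₂ (inj₂ (_ , kac)) = inj₂ (inj₂ (inj₁ kac))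
... | inj₂ (inj₁ (sac , _)) with arms-trichotomy gb gc
...   | inj₁ refl             = inj₂ (inj₁ refl)
...   | inj₂ (inj₂ (_ , kbc)) = inj₂ (inj₂ (inj₂ kbc))
...   | inj₂ (inj₁ (sbc , _)) with addC-cancelʳ {a} {b} {c} (trans sac (sym sbc))
...     | refl = ⊥-elim (king-irrefl k)

turns-straight : ∀ {a e b} → Straight a e b → turns a e b ≡ false
turns-straight {a₁ , a₂} {e₁ , e₂} {b₁ , b₂} st
  with a₁ + b₁ ≡ᵇ 2 * e₁ | ≡⇒≡ᵇ _ _ (cong proj₁ st)
     | a₂ + b₂ ≡ᵇ 2 * e₂ | ≡⇒≡ᵇ _ _ (cong proj₂ st)
... | true | _ | true | _ = refl

turns-bent : ∀ {a e b} → ¬ Straight a e b → turns a e b ≡ true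
turns-bent {a₁ , a₂} {e₁ , e₂} {b₁ , b₂} bent
  with a₁ + b₁ ≡ᵇ 2 * e₁ in h₁ | a₂ + b₂ ≡ᵇ 2 * e₂ in h₂
... | false | _     = refl
... | true  | false = refl
... | true  | true  =
  ⊥-elim (bent (cong₂ _,_ (≡ᵇ⇒≡ _ _ (subst T (sym h₁) tt)) (≡ᵇ⇒≡ _ _ (subst T (sym h₂) tt))))

Linked-++⁻ʳ : ∀ {A : Set} {R : A → A → Set} L {Q} → Linked R (L ++ Q) → Linked R Q
Linked-++⁻ʳ []                  l       = l
Linked-++⁻ʳ (x ∷ [])    {[]}    _       = []
Linked-++⁻ʳ (x ∷ [])    {y ∷ Q} (_ ∷ l) = l
Linked-++⁻ʳ (x ∷ y ∷ L)         (_ ∷ l) = Linked-++⁻ʳ (y ∷ L) l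

Unique-++⁻ʳ : ∀ {A : Set} (L : List A) {Q} → Unique (L ++ Q) → Unique Q
Unique-++⁻ʳ []      u       = u
Unique-++⁻ʳ (x ∷ L) (_ ∷ u) = Unique-++⁻ʳ L u

Unique-∷ʳ : ∀ {A : Set} {xs : List A} {x} → Unique xs → x ∉ xs → Unique (xs ∷ʳ x)
Unique-∷ʳ u x∉xs = Unique.++⁺ u ([] ∷ []) λ { (x∈xs , here refl) → x∉xs x∈xs }

∈-edges : ∀ {R : Cell → Cell → Set} {L u v} → Linked R L → (u , v) ∈ edges L → u ∈ L × v ∈ L × R u v
∈-edges (r ∷ l) (here refl) = here refl , there (here refl) , r
∈-edges (r ∷ l) (there e) with ∈-edges l e
... | u∈ , v∈ , ruv = there u∈ , there v∈ , ruv

module _ {Q : Cell × Cell → Set} (Q? : Decidable Q) where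

  count : List Cell → ℕ
  count L = length (filter Q? (edges L))

  count-∷ : ∀ x L → count L ≤ count (x ∷ L)
  count-∷ x []      = ≤-refl
  count-∷ x (y ∷ L) with Q? (x , y)
  ... | yes _ = n≤1+n (count (y ∷ L))
  ... | no _  = ≤-refl

  count-++ : ∀ L M → count M ≤ count (L ++ M)
  count-++ []      M = ≤-refl
  count-++ (x ∷ L) M = ≤-trans (count-++ L M) (count-∷ x (L ++ M))

  count-two-edges : ∀ L {a b c M} → Q (a , b) → Q (b , c) → 2 ≤ count (L ++ a ∷ b ∷ c ∷ M)
  count-two-edges L {a} {b} {c} {M} qab qbc =
    ≤-trans (subst (2 ≤_) (sym (cong length (trans (filter-accept Q? qab) (cong (_ ∷_) (filter-accept Q? qbc)))))
                   (s≤s (s≤s z≤n)))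
            (count-++ L (a ∷ b ∷ c ∷ M))

length≡1⇒∈ : ∀ {A : Set} (xs : List A) → length xs ≡ 1 → ∃[ x ] x ∈ xs
length≡1⇒∈ (x ∷ _) _ = x , here refl

module _ {R : Cell → Cell → Set} where

  FarNonAdj-map : ∀ {R' : Cell → Cell → Set} → (∀ {u v} → R' u v → R u v) →
                  ∀ p → FarNonAdj R p → FarNonAdj R' p
  FarNonAdj-map f []          _       = tt
  FarNonAdj-map f (u ∷ [])    _       = tt
  FarNonAdj-map f (u ∷ v ∷ p) (a , h) = All.map (λ ¬r → ¬r ∘ f) a , FarNonAdj-map f (v ∷ p) h

  FarNonAdj-tail : ∀ {x p} → FarNonAdj R (x ∷ p) → FarNonAdj R p
  FarNonAdj-tail {p = []}    _       = tt
  FarNonAdj-tail {p = _ ∷ _} (_ , h) = h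

  FarNonAdj-++⁻ʳ : ∀ L {p} → FarNonAdj R (L ++ p) → FarNonAdj R p
  FarNonAdj-++⁻ʳ []      h = h
  FarNonAdj-++⁻ʳ (x ∷ L) h = FarNonAdj-++⁻ʳ L (FarNonAdj-tail h)

  FarNonAdj-neighbour : (∀ {u} → ¬ R u u) → (∀ {u v} → R u v → R v u) →
                        ∀ L {m Q x} → FarNonAdj R (L ++ m ∷ Q) → x ∈ L ++ m ∷ Q → R m x →
                        (∃[ L' ] L ≡ L' ∷ʳ x) ⊎ (∃[ Q' ] Q ≡ x ∷ Q')
  FarNonAdj-neighbour irr R-sym [] f (here refl) r = ⊥-elim (irr r)
  FarNonAdj-neighbour irr R-sym [] {Q = _ ∷ Q} f (there (here refl)) r = inj₂ (Q , refl)
  FarNonAdj-neighbour irr R-sym [] {Q = _ ∷ _} f (there (there x∈)) r = ⊥-elim (All.lookup (proj₁ f) x∈ r)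
  FarNonAdj-neighbour irr R-sym (l ∷ []) f (here refl) r = inj₁ ([] , refl)
  FarNonAdj-neighbour irr R-sym (l ∷ l' ∷ L) f (here refl) r =
    ⊥-elim (All.lookup (proj₁ f) (∈-++⁺ʳ L (here refl)) (R-sym r))
  FarNonAdj-neighbour irr R-sym (l ∷ L) f (there x∈) r
    with FarNonAdj-neighbour irr R-sym L (FarNonAdj-tail f) x∈ r
  ... | inj₁ (L' , refl) = inj₁ (l ∷ L' , refl)
  ... | inj₂ q           = inj₂ q

near-half-bound : ∀ k {x y} → Near x y → x + y < 2 * k ∸ 1 → x < k
near-half-bound k {x} {y} n =
  half-bound k (subst (2 * x ≤_) (+-suc x y)
                 (+-monoʳ-≤ x (subst (_≤ suc y) (sym (+-identityʳ x)) (near≤1+ n))))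

dbl-inside : ∀ k {v} → InSquare k v → InSquare (2 * k ∸ 1) (dbl v)
dbl-inside k (h₁ , h₂) = double-bound k h₁ , double-bound k h₂

dbl-inside⁻ : ∀ k {v} → InSquare (2 * k ∸ 1) (dbl v) → InSquare k v
dbl-inside⁻ k {v₁ , v₂} (h₁ , h₂) = half-bound k (n≤1+n (2 * v₁)) h₁ , half-bound k (n≤1+n (2 * v₂)) h₂

mid-inside⁻ : ∀ k {r c} → Grid r c → InSquare (2 * k ∸ 1) (addC r c) → InSquare k r × InSquare k c
mid-inside⁻ k (horizontal {x} {x'} s) (h₁ , h₂) =
  (near-half-bound k (step⇒near s) h₁ , near-half-bound k (same refl) h₂) ,
  ( near-half-bound k (near-sym (step⇒near s)) (subst (_< 2 * k ∸ 1) (+-comm x x') h₁)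
  , near-half-bound k (same refl) h₂)
mid-inside⁻ k (vertical {y = y} {y'} s) (h₁ , h₂) =
  (near-half-bound k (same refl) h₁ , near-half-bound k (step⇒near s) h₂) ,
  ( near-half-bound k (same refl) h₁
  , near-half-bound k (near-sym (step⇒near s)) (subst (_< 2 * k ∸ 1) (+-comm y y') h₂))

star-inside : ∀ k {e z} → InStar e z → InSquare (2 * k ∸ 1) z → InSquare k e
star-inside k (inj₁ refl) h = dbl-inside⁻ k h
star-inside k {e} (inj₂ g) h with grid-dbl⁻ {e} g
... | a , ga , refl = proj₁ (mid-inside⁻ k ga h)

-- The map ψ

ψ-tail-straight : ∀ {r c d} rest → Straight r c d →
                  ψ-tail r (c ∷ d ∷ rest) ≡ addC r c ∷ dbl c ∷ ψ-tail c (d ∷ rest)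
ψ-tail-straight {r} {c} {d} rest st =
  cong (λ b → addC r c ∷ (if b then [] else dbl c ∷ []) ++ ψ-tail c (d ∷ rest)) (turns-straight {r} {c} {d} st)

ψ-tail-bent : ∀ {r c d} rest → ¬ Straight r c d →
              ψ-tail r (c ∷ d ∷ rest) ≡ addC r c ∷ ψ-tail c (d ∷ rest)
ψ-tail-bent {r} {c} {d} rest bent =
  cong (λ b → addC r c ∷ (if b then [] else dbl c ∷ []) ++ ψ-tail c (d ∷ rest)) (turns-bent {r} {c} {d} bent)

edge-star : ∀ {a b c ρ} → Grid a b → InStar c (addC a b) → c ∈ a ∷ b ∷ ρ
edge-star {c = c} g s with star-mid {c} g s
... | inj₁ refl = here refl
... | inj₂ refl = there (here refl)

ψ-tail-star : ∀ {a ρ z c} → Linked Grid (a ∷ ρ) → z ∈ ψ-tail a ρ → InStar c z → c ∈ a ∷ ρ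
ψ-tail-star {ρ = b ∷ []}    (g ∷ _) (here refl) s = edge-star g s
ψ-tail-star {ρ = b ∷ _ ∷ _} (g ∷ _) (here refl) s = edge-star g s
ψ-tail-star {ρ = b ∷ []} {c = c} _ (there (here refl)) s = there (here (star-dbl {c} s))
ψ-tail-star {a} {b ∷ d ∷ ρ} {c = c} (g ∷ l) (there z∈) s with turns a b d
... | true = there (ψ-tail-star l z∈ s)
... | false with z∈
...   | here refl = there (here (star-dbl {c} s))
...   | there z∈' = there (ψ-tail-star l z∈' s)

ψ-star : ∀ {ρ z c} → Linked Grid ρ → z ∈ ψ ρ → InStar c z → c ∈ ρ
ψ-star {_ ∷ _} {c = c} l (here refl) s = here (star-dbl {c} s)
ψ-star {_ ∷ _} l (there z∈) s = ψ-tail-star l z∈ s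

-- Decoding the snake

-- How P arrives at the midpoint of r─c: from 2r, or cutting the corner q─r─c.
data Entry (r c : Cell) : Cell → Set where
  via-centre : Entry r c (dbl r)
  via-corner : ∀ {q} → Grid q r → ¬ Straight q r c → Entry r c (addC q r)

data Exit (r c : Cell) : List Cell → Set where
  end        : Exit r c (dbl c ∷ [])
  via-centre : ∀ {d S} → Grid c d → Straight r c d → Exit r c (dbl c ∷ addC c d ∷ S)
  via-corner : ∀ {d S} → Grid c d → ¬ Straight r c d → Exit r c (addC c d ∷ S)

entry-star : ∀ {r c pre} → Entry r c pre → InStar r pre
entry-star via-centre                = inj₁ refl
entry-star {r} (via-corner {q} g _) = inj₂ (subst (Grid (dbl r)) (addC-comm r q) (grid-dbl-mid (grid-sym g)))

entry-king : ∀ {r c a pre} → Entry r c pre → Grid r a → Straight c r a → pre ≢ addC r c → King pre (addC r a)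
entry-king via-centre ga st _ = grid⇒king (grid-dbl-mid ga)
entry-king {r} {c} {a} (via-corner {q} gq bent) ga st pre≢m =
  king-addC-comm q r (king-arms (grid-sym gq) ga (λ { refl → bent (straight-sym {c} {r} {a} st) }) q-a-bent)
  where
  q-a-bent : ¬ Straight q r a
  q-a-bent sqa with addC-cancelʳ {q} {c} {a} (trans sqa (sym st))
  ... | refl = pre≢m (addC-comm c r)

module NiceSnake (k : ℕ) (P : List Cell)
  (snake : IsSnake (InSquare (2 * k ∸ 1)) KingAdj P)
  (nice : ∀ a → InSquare (2 * k ∸ 1) a → EvenCell a → Nice (2 * k ∸ 1) P a)
  (¬odd : ∀ c → c ∈ P → ¬ OddCell c) where

  P-inside : ∀ {x} → x ∈ P → InSquare (2 * k ∸ 1) x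
  P-inside = All.lookup (proj₁ (proj₂ (proj₁ snake)))

  P-unique : Unique P
  P-unique = proj₁ (proj₂ (proj₂ (proj₁ snake)))

  P-linked : Linked King P
  P-linked = Linked.map (λ {u} {v} → KingAdj⇒King u v) (proj₂ (proj₂ (proj₂ (proj₁ snake))))

  P-induced : FarNonAdj King P
  P-induced = FarNonAdj-map King⇒KingAdj P (proj₂ snake)

  suffix-∈ : ∀ L {Q x} → P ≡ L ++ Q → x ∈ Q → x ∈ P
  suffix-∈ L eq x∈ = subst (_ ∈_) (sym eq) (∈-++⁺ʳ L x∈)

  suffix-unique : ∀ L {Q} → P ≡ L ++ Q → Unique Q
  suffix-unique L eq = Unique-++⁻ʳ L (subst Unique eq P-unique)

  suffix-linked : ∀ L {Q} → P ≡ L ++ Q → Linked King Q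
  suffix-linked L eq = Linked-++⁻ʳ L (subst (Linked King) eq P-linked)

  suffix-induced : ∀ L {Q} → P ≡ L ++ Q → FarNonAdj King Q
  suffix-induced L eq = FarNonAdj-++⁻ʳ L (subst (FarNonAdj King) eq P-induced)

  P-neighbour : ∀ L {m Q x} → P ≡ L ++ m ∷ Q → x ∈ P → King m x →
                (∃[ L' ] L ≡ L' ∷ʳ x) ⊎ (∃[ Q' ] Q ≡ x ∷ Q')
  P-neighbour L eq x∈ =
    FarNonAdj-neighbour king-irrefl king-sym L (subst (FarNonAdj King) eq P-induced) (subst (_ ∈_) eq x∈)

  interior-neighbour : ∀ L {a b c Q x} → P ≡ L ++ a ∷ b ∷ c ∷ Q → x ∈ P → King b x → x ≡ a ⊎ x ≡ c
  interior-neighbour L {a} {b} {c} {Q} eq x∈ k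
    with P-neighbour (L ∷ʳ a) (trans eq (sym (++-assoc L (a ∷ []) (b ∷ c ∷ Q)))) x∈ k
  ... | inj₁ (L' , e)    = inj₁ (sym (∷ʳ-injectiveʳ L L' e))
  ... | inj₂ (Q' , refl) = inj₂ refl

  last-neighbour : ∀ L {a b x} → P ≡ L ++ a ∷ b ∷ [] → x ∈ P → King b x → x ≡ a
  last-neighbour L {a} {b} eq x∈ k with P-neighbour (L ∷ʳ a) (trans eq (sym (++-assoc L (a ∷ []) (b ∷ [])))) x∈ k
  ... | inj₁ (L' , e) = sym (∷ʳ-injectiveʳ L L' e)
  ... | inj₂ (_ , ())

  first-neighbour : ∀ {b c Q x} → P ≡ b ∷ c ∷ Q → x ∈ P → King b x → x ≡ c
  first-neighbour eq x∈ k with P-neighbour [] eq x∈ k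
  ... | inj₁ ([] , ())
  ... | inj₁ (_ ∷ _ , ())
  ... | inj₂ (_ , refl) = refl

  cross-edge? : (a : Cell) → Decidable _
  cross-edge? a e = inCross? (2 * k ∸ 1) a (proj₁ e) ×-dec inCross? (2 * k ∸ 1) a (proj₂ e)

  single-cross-edge : ∀ {a} → crossEdgeCount (2 * k ∸ 1) a P ≡ 1 →
                      ∃[ u ] ∃[ v ] u ∈ P × v ∈ P × King u v × Grid a u × Grid a v
  single-cross-edge {a} h with length≡1⇒∈ (filter (cross-edge? a) (edges P)) h
  ... | (u , v) , e∈ with ∈-filter⁻ (cross-edge? a) {xs = edges P} e∈
  ...   | e∈P , (au , _) , (av , _) with ∈-edges P-linked e∈P
  ...     | u∈ , v∈ , kuv = u , v , u∈ , v∈ , kuv , GridAdj⇒Grid _ _ au , GridAdj⇒Grid _ _ av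

  nice-dbl : ∀ {c} → InSquare k c → Nice (2 * k ∸ 1) P (dbl c)
  nice-dbl {c} h = nice (dbl c) (dbl-inside k h) (dbl-even c)

  star-visited : ∀ {c} → InSquare k c → ∃[ z ] z ∈ P × InStar c z
  star-visited {c} h with nice-dbl h
  ... | inj₁ 2c∈      = dbl c , 2c∈ , inj₁ refl
  ... | inj₂ (_ , n₁) with single-cross-edge n₁
  ...   | u , _ , u∈ , _ , _ , gu , _ = u , u∈ , inj₂ gu

  -- Either 2c lies on P, or an end of the single edge of P inside the cross of 2c is, or is adjacent to,
  -- the midpoint.
  star-neighbour : ∀ {r c} → Grid r c → addC r c ∈ P → ∃[ x ] x ∈ P × King (addC r c) x × InStar c x
  star-neighbour {r} {c} g m∈ with nice-dbl (proj₂ (mid-inside⁻ k g (P-inside m∈)))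
  ... | inj₁ 2c∈ =
    dbl c , 2c∈ , king-sym (grid⇒king (subst (Grid (dbl c)) (addC-comm c r) (grid-dbl-mid (grid-sym g)))) , inj₁ refl
  ... | inj₂ (_ , n₁) with single-cross-edge n₁
  ...   | u , v , u∈ , v∈ , kuv , gu , gv with grid-dbl⁻ {c} gu | grid-dbl⁻ {c} gv
  ...     | a , ga , refl | b , gb , refl with third-arm ga gb (grid-sym g) kuv
  ...       | inj₁ refl              = addC c b , v∈ , king-addC-comm r c kuv , inj₂ gv
  ...       | inj₂ (inj₁ refl)       = addC c a , u∈ , king-addC-comm r c (king-sym kuv) , inj₂ gu
  ...       | inj₂ (inj₂ (inj₁ kar)) = addC c a , u∈ , king-addC-comm r c (king-sym kar) , inj₂ gu
  ...       | inj₂ (inj₂ (inj₂ kbr)) = addC c b , v∈ , king-addC-comm r c (king-sym kbr) , inj₂ gv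

  -- Its only neighbour would lie in the stars of both r and c, which meet only in the midpoint itself.
  ¬mid-end : ∀ {r c w} → Grid r c → addC r c ∈ P → (∀ {x} → x ∈ P → King (addC r c) x → x ≡ w) → ⊥
  ¬mid-end {r} {c} g m∈ only
    with star-neighbour g m∈ | star-neighbour (grid-sym g) (subst (_∈ P) (addC-comm r c) m∈)
  ... | x , x∈ , kx , sx | y , y∈ , ky , sy with only x∈ kx | only y∈ (king-addC-comm r c ky)
  ... | refl | refl = king-irrefl (subst (King _) (star-meet g sy sx) kx)

  two-cross-edges : ∀ L {a b c e Q} → P ≡ L ++ a ∷ b ∷ c ∷ Q →
                    Grid (dbl e) a → Grid (dbl e) b → Grid (dbl e) c → 2 ≤ crossEdgeCount (2 * k ∸ 1) (dbl e) P
  two-cross-edges L {a} {b} {c} {e} {Q} eq ga gb gc =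
    subst (λ p → 2 ≤ count (cross-edge? (dbl e)) p) (sym eq)
      (count-two-edges (cross-edge? (dbl e)) L {a} {b} {c} {Q}
        (in-cross ga (here refl) , in-cross gb (there (here refl)))
        (in-cross gb (there (here refl)) , in-cross gc (there (there (here refl)))))
    where
    in-cross : ∀ {z} → Grid (dbl e) z → z ∈ a ∷ b ∷ c ∷ Q → InCross (2 * k ∸ 1) (dbl e) z
    in-cross g z∈ = Grid⇒GridAdj g , P-inside (suffix-∈ L eq z∈)

  ¬cross-triple : ∀ L {a b c e Q} → P ≡ L ++ a ∷ b ∷ c ∷ Q →
                  Grid (dbl e) a → Grid (dbl e) b → Grid (dbl e) c → ⊥
  ¬cross-triple L {e = e} eq ga gb gc
    with nice-dbl (star-inside k {e} (inj₂ gb) (P-inside (suffix-∈ L eq (there (here refl)))))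
  ... | inj₁ 2e∈ with interior-neighbour L eq 2e∈ (king-sym (grid⇒king gb))
  ...   | inj₁ refl = grid-irrefl ga
  ...   | inj₂ refl = grid-irrefl gc
  ¬cross-triple L {e = e} eq ga gb gc | inj₂ (_ , n₁) =
    contradiction (subst (2 ≤_) n₁ (two-cross-edges L {e = e} eq ga gb gc)) λ { (s≤s ()) }

  ¬star-triple : ∀ L {a b c e Q} → P ≡ L ++ a ∷ b ∷ c ∷ Q → InStar e a → Grid (dbl e) b → InStar e c → ⊥
  ¬star-triple L {e = e} eq sa gb sc with suffix-unique L eq | suffix-induced L eq
  ... | a∉ ∷ _ | far-a , _ = triple sa sc
    where
    triple : InStar e _ → InStar e _ → ⊥
    triple (inj₁ refl) (inj₁ refl) = All.lookup a∉ (there (here refl)) refl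
    triple (inj₁ refl) (inj₂ gc)   = All.lookup far-a (here refl) (grid⇒king gc)
    triple (inj₂ ga)   (inj₁ refl) = All.lookup far-a (here refl) (king-sym (grid⇒king ga))
    triple (inj₂ ga)   (inj₂ gc)   = ¬cross-triple L {e = e} eq ga gb gc

  exit-centre : ∀ L {pre r c S} → P ≡ L ++ pre ∷ addC r c ∷ dbl c ∷ S → Grid r c → Exit r c (dbl c ∷ S)
  exit-centre L {S = []} eq g = end
  exit-centre L {pre} {r} {c} {y ∷ S} eq g with suffix-linked L eq
  ... | _ ∷ _ ∷ c~y ∷ _
    with grid-dbl⁻ {c} (king-centre {c} (¬odd y (suffix-∈ L eq (there (there (there (here refl)))))) c~y)
  ...   | d , gd , refl with arms-trichotomy (grid-sym g) gd | suffix-unique L eq | suffix-induced L eq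
  ...     | inj₁ refl            | _ ∷ (m∉ ∷ _) | _            = ⊥-elim (All.lookup m∉ (there (here refl)) (addC-comm r c))
  ...     | inj₂ (inj₁ (st , _)) | _            | _            = via-centre gd st
  ...     | inj₂ (inj₂ (_ , k))  | _            | _ , far-m , _ = ⊥-elim (All.lookup far-m (here refl) (king-addC-comm r c k))

  exit-corner : ∀ L {pre r c x S} → P ≡ L ++ pre ∷ addC r c ∷ x ∷ S → Grid r c →
                King (addC r c) x → Grid (dbl c) x → Exit r c (x ∷ S)
  exit-corner L {r = r} {c} eq g m~x h with grid-dbl⁻ {c} h
  ... | d , gd , refl with arms-trichotomy (grid-sym g) gd | suffix-unique L eq
  ...   | inj₁ refl              | _ ∷ (m∉ ∷ _) = ⊥-elim (All.lookup m∉ (here refl) (addC-comm r c))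
  ...   | inj₂ (inj₁ (_ , ¬k))   | _            = ⊥-elim (¬k (king-addC-comm c r m~x))
  ...   | inj₂ (inj₂ (bent , _)) | _            = via-corner gd bent

  exit : ∀ L {pre r c S} → P ≡ L ++ pre ∷ addC r c ∷ S → Grid r c → Entry r c pre → Exit r c S
  exit L {S = []} eq g e = ⊥-elim (¬mid-end g (suffix-∈ L eq (there (here refl))) (last-neighbour L eq))
  exit L {pre} {r} {c} {x ∷ S} eq g e with suffix-linked L eq
  ... | _ ∷ m~x ∷ _ with king-mid g (¬odd x (suffix-∈ L eq (there (there (here refl))))) m~x
  ...   | inj₁ sx          = ⊥-elim (¬star-triple L {e = r} eq (entry-star e) (grid-dbl-mid g) sx)
  ...   | inj₂ (inj₁ refl) = exit-centre L eq g
  ...   | inj₂ (inj₂ h)    = exit-corner L eq g m~x h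

  -- Every cell of the star of r is adjacent to the midpoint of r─c or to the cell before it.
  star-left-behind : ∀ L {pre r c w U z} → P ≡ L ++ pre ∷ addC r c ∷ w ∷ U → Grid r c → Entry r c pre →
                     z ∈ U → ¬ InStar r z
  star-left-behind L eq g e z∈ (inj₁ refl) with suffix-induced L eq
  ... | _ , far-m , _ = All.lookup far-m z∈ (king-sym (grid⇒king (grid-dbl-mid g)))
  star-left-behind L {r = r} eq g e z∈ (inj₂ h) with grid-dbl⁻ {r} h
  ... | a , ga , refl with arms-trichotomy g ga | suffix-unique L eq | suffix-induced L eq
  ...   | inj₁ refl            | _ ∷ (m∉ ∷ _) | _             = All.lookup m∉ (there z∈) refl
  ...   | inj₂ (inj₂ (_ , k))  | _            | _ , far-m , _ = All.lookup far-m z∈ k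
  ...   | inj₂ (inj₁ (st , _)) | pre∉ ∷ _     | far-pre , _   =
    All.lookup far-pre (there z∈) (entry-king e ga st (All.lookup pre∉ (here refl)))

  record Decoded (Vs : List Cell) (r c : Cell) (S : List Cell) : Set where
    field
      rest   : List Cell
      shape  : addC r c ∷ S ≡ ψ-tail r (c ∷ rest)
      walk   : Linked Grid (r ∷ c ∷ rest)
      inside : All (InSquare k) (c ∷ rest)
      fresh  : Unique (Vs ++ r ∷ c ∷ rest)

  Avoids : List Cell → List Cell → Set
  Avoids Vs T = ∀ {v z} → v ∈ Vs → z ∈ T → ¬ InStar v z

  avoids-∷ʳ : ∀ {Vs r T T'} → Avoids Vs T → (∀ {z} → z ∈ T' → z ∈ T) → (∀ {z} → z ∈ T' → ¬ InStar r z) →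
              Avoids (Vs ∷ʳ r) T'
  avoids-∷ʳ {Vs} av T'⊆T new v∈ z∈ with ∈-++⁻ Vs v∈
  ... | inj₁ v∈Vs        = av v∈Vs (T'⊆T z∈)
  ... | inj₂ (here refl) = new z∈

  fresh-∷ʳ : ∀ {Vs r c S} → Grid r c → Unique (Vs ∷ʳ r) → Avoids Vs (addC r c ∷ S) → Unique ((Vs ∷ʳ r) ∷ʳ c)
  fresh-∷ʳ {Vs} {r} {c} g u av = Unique-∷ʳ u c∉
    where
    c∉ : c ∉ Vs ∷ʳ r
    c∉ c∈ with ∈-++⁻ Vs c∈
    ... | inj₁ c∈Vs        = av c∈Vs (here refl) (subst (InStar c) (addC-comm c r) (mid-in-star (grid-sym g)))
    ... | inj₂ (here refl) = grid-irrefl g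

  prolong : ∀ {Vs r c d S'} pfx → Grid r c → InSquare k c →
            (∀ rest → ψ-tail r (c ∷ d ∷ rest) ≡ addC r c ∷ pfx ++ ψ-tail c (d ∷ rest)) →
            Decoded (Vs ∷ʳ r) c d S' → Decoded Vs r c (pfx ++ addC c d ∷ S')
  prolong {Vs} {r} {c} {d} pfx g c-in ψ-eq D = record
    { rest   = d ∷ rest
    ; shape  = trans (cong (λ t → addC r c ∷ pfx ++ t) shape) (sym (ψ-eq rest))
    ; walk   = g ∷ walk
    ; inside = c-in ∷ inside
    ; fresh  = subst Unique (++-assoc Vs (r ∷ []) (c ∷ d ∷ rest)) fresh
    }
    where open Decoded D

  decode : ∀ L {pre r c S Vs} → P ≡ L ++ pre ∷ addC r c ∷ S → Grid r c → Entry r c pre →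
           Unique (Vs ∷ʳ r) → Avoids Vs (addC r c ∷ S) → Decoded Vs r c S
  decode L {pre} {r} {c} {S} {Vs} eq g e u av with exit L eq g e
  ... | end = record
    { rest   = []
    ; shape  = refl
    ; walk   = g ∷ [-]
    ; inside = c-in ∷ []
    ; fresh  = subst Unique (++-assoc Vs (r ∷ []) (c ∷ [])) (fresh-∷ʳ g u av)
    }
    where c-in = proj₂ (mid-inside⁻ k g (P-inside (suffix-∈ L eq (there (here refl)))))
  ... | via-centre {d} {S'} gd st =
    prolong (dbl c ∷ []) g c-in (λ rest → ψ-tail-straight rest st)
      (decode (L ++ pre ∷ addC r c ∷ []) (trans eq (sym (++-assoc L (pre ∷ addC r c ∷ []) _))) gd via-centre
              (fresh-∷ʳ g u av) (avoids-∷ʳ av (there ∘ there) (star-left-behind L eq g e)))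
    where c-in = proj₂ (mid-inside⁻ k g (P-inside (suffix-∈ L eq (there (here refl)))))
  ... | via-corner {d} {S'} gd bent =
    prolong [] g c-in (λ rest → ψ-tail-bent rest bent)
      (decode (L ++ pre ∷ []) (trans eq (sym (++-assoc L (pre ∷ []) _))) gd (via-corner g bent)
              (fresh-∷ʳ g u av) (avoids-∷ʳ av there left))
    where
    c-in = proj₂ (mid-inside⁻ k g (P-inside (suffix-∈ L eq (there (here refl)))))
    left : ∀ {z} → z ∈ addC c d ∷ S' → ¬ InStar r z
    left (here refl) s with star-mid {r} gd s | suffix-unique L eq
    ... | inj₁ refl | _            = grid-irrefl g
    ... | inj₂ refl | _ ∷ (m∉ ∷ _) = All.lookup m∉ (here refl) (addC-comm r c)
    left (there z∈) = star-left-behind L eq g e z∈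

  Decoding : Set
  Decoding = ∃[ ρ ] P ≡ ψ ρ × ρ ≢ [] × Linked Grid ρ × All (InSquare k) ρ × Unique ρ

  decode-from-centre : ∀ r R → P ≡ dbl r ∷ R → Decoding
  decode-from-centre r [] eq =
    r ∷ [] , eq , (λ ()) , [-] , dbl-inside⁻ k (P-inside (subst (_ ∈_) (sym eq) (here refl))) ∷ [] , [] ∷ []
  decode-from-centre r (m ∷ S) eq with subst (Linked King) eq P-linked
  ... | r~m ∷ _ with grid-dbl⁻ {r} (king-centre {r} (¬odd m m∈) r~m)
    where m∈ = suffix-∈ (dbl r ∷ []) eq (here refl)
  ... | c , g , refl = r ∷ c ∷ rest , trans eq (cong (dbl r ∷_) shape) , (λ ()) , walk , r-in ∷ inside , fresh
    where
    open Decoded (decode [] {Vs = []} eq g via-centre ([] ∷ []) (λ ()))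
    r-in = proj₁ (mid-inside⁻ k g (P-inside (suffix-∈ (dbl r ∷ []) eq (here refl))))

  decoding : Decoding
  decoding = from P refl
    where
    from : ∀ Q → P ≡ Q → Decoding
    from [] eq = ⊥-elim (proj₁ (proj₁ snake) eq)
    from (p ∷ R) eq with classify p (¬odd p (subst (p ∈_) (sym eq) (here refl)))
    ... | inj₁ (r , refl) = decode-from-centre r R eq
    ... | inj₂ (r , c , g , refl) = ⊥-elim (mid-start R eq)
      where
      mid-start : ∀ R → P ≡ addC r c ∷ R → ⊥
      mid-start []      eq =
        ¬mid-end g (subst (_ ∈_) (sym eq) (here refl)) (λ x∈ _ → only-cell (subst (_ ∈_) eq x∈))
        where
        only-cell : ∀ {x} → x ∈ addC r c ∷ [] → x ≡ addC r c
        only-cell (here e) = e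
      mid-start (_ ∷ _) eq = ¬mid-end g (subst (_ ∈_) (sym eq) (here refl)) (first-neighbour eq)

  covered : ∀ {ρ} → Linked Grid ρ → P ≡ ψ ρ → ∀ c → InSquare k c → c ∈ ρ
  covered walk eq c c-in with star-visited c-in
  ... | z , z∈ , s = ψ-star walk (subst (z ∈_) eq z∈) s

lemma5 : (k : ℕ) → 1 ≤ k →
    (P : List Cell) →
    IsSnake (InSquare (2 * k ∸ 1)) KingAdj P →
    (∀ Q → IsSnake (InSquare (2 * k ∸ 1)) KingAdj Q → pathLength Q ≤ pathLength P) →
    (∀ a → InSquare (2 * k ∸ 1) a → EvenCell a → Nice (2 * k ∸ 1) P a) →
    (∀ c → c ∈ P → ¬ OddCell c) →
    Σ (List Cell) (λ ρ → IsHamiltonian (InSquare k) GridAdj ρ × P ≡ ψ ρ)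
lemma5 k _ P snake _ nice ¬odd with NiceSnake.decoding k P snake nice ¬odd
... | ρ , P≡ψρ , ρ≢[] , walk , inside , unique =
  ρ , ( (ρ≢[] , inside , unique , Linked.map Grid⇒GridAdj walk)
      , NiceSnake.covered k P snake nice ¬odd walk P≡ψρ) , P≡ψρ
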